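{- Let $G$ be a graph and $H$ a graph admitting a barbell partition. Then for any vertex $v$ of $G$ and any vertex of $H$ identified with it, the vertex sum $K=G\oplus_v H$ admits a barbell partition.
   Context: All graphs are finite and simple. The vertex sum $G\oplus_v H$ is the graph obtained from disjoint copies of $G$ and $H$ by identifying a chosen vertex of $G$ with a chosen vertex of $H$, the identified vertex being called $v$. A barbell partition of a graph $K$ is a partition of $V(K)$ into three disjoint sets $\{R,W_1,W_2\}$ with $W_1,W_2\neq\emptyset$ ($R$ may be empty), no edges between $W_1$ and $W_2$, and $|N_K(r)\cap W_i|\neq 1$ for all $r\in R$, $i\in\{1,2\}$. -}

module Defs where

open import Data.Nat using (ℕ; zero; suc; _+_)
open import Data.Bool using (Bool; true; false; _∧_; _∨_; if_then_else_)
open import Data.Fin using (Fin; zero; suc; splitAt; punchIn; _≟_)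
open import Data.Maybe using (Maybe; just; nothing)
open import Data.Sum using (inj₁; inj₂)
open import Data.Product using (Σ; ∃; _×_; _,_)
open import Relation.Nullary using (¬_; does)
open import Relation.Binary.PropositionalEquality using (_≡_)

record SimpleGraph (n : ℕ) : Set where
  field
    adj    : Fin n → Fin n → Bool
    sym    : ∀ x y → adj x y ≡ adj y x
    irrefl : ∀ x → adj x x ≡ false
open SimpleGraph public

count : ∀ {n} → (Fin n → Bool) → ℕ
count {zero}  p = 0
count {suc n} p = (if p zero then 1 else 0) + count (λ i → p (suc i))

data Block : Set where
  R W₁ W₂ : Block

isBlock : Block → Block → Bool
isBlock R  R  = true
isBlock W₁ W₁ = true
isBlock W₂ W₂ = true
isBlock _  _  = false

nbrsIn : ∀ {n} → (Fin n → Fin n → Bool) → (Fin n → Block) → Fin n → Block → ℕ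
nbrsIn adjK lab r b = count (λ x → adjK r x ∧ isBlock (lab x) b)

record BarbellPartition {n : ℕ} (adjK : Fin n → Fin n → Bool) : Set where
  field
    label      : Fin n → Block
    W₁-nonempty : ∃ λ x → label x ≡ W₁
    W₂-nonempty : ∃ λ x → label x ≡ W₂
    no-edges   : ∀ x y → label x ≡ W₁ → label y ≡ W₂ → adjK x y ≡ false
    R-cond₁    : ∀ r → label r ≡ R → ¬ (nbrsIn adjK label r W₁ ≡ 1)
    R-cond₂    : ∀ r → label r ≡ R → ¬ (nbrsIn adjK label r W₂ ≡ 1)

-- The vertex sum has vertices Fin (m + n): the first m are the vertices of G,
-- the last n are the vertices of H other than w; vertex w of H is
-- identified with vertex u of G.
-- preimage of a vertex of the sum in G
preG : ∀ {m n} → Fin (m + n) → Maybe (Fin m)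
preG {m} x with splitAt m x
... | inj₁ i = just i
... | inj₂ _ = nothing

preH : ∀ {m n} → Fin m → Fin (suc n) → Fin (m + n) → Maybe (Fin (suc n))
preH {m} u w x with splitAt m x
... | inj₁ i = if does (i ≟ u) then just w else nothing
... | inj₂ j = just (punchIn w j)

adjVia : ∀ {k} → (Fin k → Fin k → Bool) → Maybe (Fin k) → Maybe (Fin k) → Bool
adjVia a (just x) (just y) = a x y
adjVia a _ _ = false

vertexSumAdj : ∀ {m n} → SimpleGraph m → SimpleGraph (suc n) →
               Fin m → Fin (suc n) → Fin (m + n) → Fin (m + n) → Bool
vertexSumAdj {m} {n} G H u w x y =
  adjVia (adj G) (preG {m} {n} x) (preG {m} {n} y)
    ∨ adjVia (adj H) (preH u w x) (preH u w y)

-- Give each vertex of G ⊕ᵥ H the block of its preimage in H, and every other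
-- vertex of G the block of the cut vertex.  H-edges keep their labels, and
-- G-edges join vertices of one block, so no W₁–W₂ edge appears.  An R-vertex
-- of the sum sees exactly the W-neighbours it had in H: its other neighbours
-- lie in G, and those are either all in R (when the cut vertex is) or, when
-- the R-vertex comes from H, reduced to the cut vertex, which it had in H too.
module Submission where

open import Defs hiding (sym)
open import Data.Nat using (ℕ; zero; suc; _+_)
open import Data.Nat.Properties using (+-assoc; +-comm; +-identityʳ; 0≢1+n)
open import Data.Fin using (Fin; zero; suc; splitAt; punchIn; punchOut; _≟_; _↑ˡ_; _↑ʳ_)
open import Data.Fin.Properties
  using (splitAt-↑ˡ; splitAt-↑ʳ; splitAt⁻¹-↑ˡ; splitAt⁻¹-↑ʳ; punchIn-punchOut; suc-injective)
open import Data.Bool using (Bool; false; _∧_; _∨_; if_then_else_)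
open import Data.Bool.Properties using (∧-zeroʳ)
open import Data.Maybe using (Maybe; just; nothing; maybe′)
open import Data.Maybe.Properties using (just-injective)
open import Data.Sum using (inj₁; inj₂)
open import Data.Product using (∃; _,_)
open import Relation.Nullary using (¬_; Dec; yes; no; contradiction)
open import Relation.Binary.PropositionalEquality
open import Function using (_∘_)

⟦_⟧ : Bool → ℕ
⟦ b ⟧ = if b then 1 else 0

count-cong : ∀ {n} {p q : Fin n → Bool} → (∀ i → p i ≡ q i) → count p ≡ count q
count-cong {zero}  e = refl
count-cong {suc n} e rewrite e zero = cong (_ +_) (count-cong (λ i → e (suc i)))

count-false : ∀ {n} {p : Fin n → Bool} → (∀ i → p i ≡ false) → count p ≡ 0
count-false {zero}  e = refl
count-false {suc n} e rewrite e zero = count-false (λ i → e (suc i))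

count-+ : ∀ m {n} (p : Fin (m + n) → Bool) →
          count p ≡ count (λ i → p (i ↑ˡ n)) + count (λ j → p (m ↑ʳ j))
count-+ zero    p = refl
count-+ (suc m) p = trans (cong (⟦ p zero ⟧ +_) (count-+ m (λ i → p (suc i))))
                          (sym (+-assoc ⟦ p zero ⟧ _ _))

count-punchIn : ∀ {n} (w : Fin (suc n)) (p : Fin (suc n) → Bool) →
                count p ≡ ⟦ p w ⟧ + count (λ j → p (punchIn w j))
count-punchIn zero p = refl
count-punchIn {suc n} (suc w) p = begin
  ⟦ p zero ⟧ + count (λ i → p (suc i))
    ≡⟨ cong (⟦ p zero ⟧ +_) (count-punchIn w (λ i → p (suc i))) ⟩
  ⟦ p zero ⟧ + (⟦ p (suc w) ⟧ + rest)
    ≡⟨ sym (+-assoc ⟦ p zero ⟧ _ _) ⟩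
  ⟦ p zero ⟧ + ⟦ p (suc w) ⟧ + rest
    ≡⟨ cong (_+ rest) (+-comm ⟦ p zero ⟧ ⟦ p (suc w) ⟧) ⟩
  ⟦ p (suc w) ⟧ + ⟦ p zero ⟧ + rest
    ≡⟨ +-assoc ⟦ p (suc w) ⟧ _ _ ⟩
  ⟦ p (suc w) ⟧ + (⟦ p zero ⟧ + rest) ∎
  where
  open ≡-Reasoning
  rest = count (λ j → p (suc (punchIn w j)))

count-only : ∀ {m} (u : Fin m) (p : Fin m → Bool) →
             (∀ i → ¬ i ≡ u → p i ≡ false) → count p ≡ ⟦ p u ⟧
count-only {suc m} zero p off =
  trans (cong (⟦ p zero ⟧ +_) (count-false (λ i → off (suc i) (λ ()))))
        (+-identityʳ ⟦ p zero ⟧)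
count-only {suc m} (suc u) p off rewrite off zero (λ ()) =
  count-only u (λ i → p (suc i)) (λ i i≢u → off (suc i) (i≢u ∘ suc-injective))

_≟R : ∀ c → Dec (c ≡ R)
R  ≟R = yes refl
W₁ ≟R = no λ ()
W₂ ≟R = no λ ()

∧-isBlock-R : ∀ {b} → isBlock R b ≡ false → ∀ a → a ∧ isBlock R b ≡ false
∧-isBlock-R b≢R a = trans (cong (a ∧_) b≢R) (∧-zeroʳ a)

adjVia-nothingʳ : ∀ {k} (a : Fin k → Fin k → Bool) mx → adjVia a mx nothing ≡ false
adjVia-nothingʳ a (just x) = refl
adjVia-nothingʳ a nothing  = refl

data SumVertex (m n : ℕ) : Fin (m + n) → Set where
  fromG : ∀ i → SumVertex m n (i ↑ˡ n)
  fromH : ∀ j → SumVertex m n (m ↑ʳ j)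

sumVertex : ∀ m n x → SumVertex m n x
sumVertex m n x with splitAt m x in eq
... | inj₁ i = subst (SumVertex m n) (splitAt⁻¹-↑ˡ eq) (fromG i)
... | inj₂ j = subst (SumVertex m n) (splitAt⁻¹-↑ʳ eq) (fromH j)

module VertexSum {m n} (G : SimpleGraph m) (H : SimpleGraph (suc n))
                 (u : Fin m) (w : Fin (suc n)) where

  K : Fin (m + n) → Fin (m + n) → Bool
  K = vertexSumAdj G H u w

  πG : Fin (m + n) → Maybe (Fin m)
  πG = preG {m} {n}

  πH : Fin (m + n) → Maybe (Fin (suc n))
  πH = preH u w

  πG-↑ʳ : ∀ j → πG (m ↑ʳ j) ≡ nothing
  πG-↑ʳ j rewrite splitAt-↑ʳ m n j = refl

  πH-↑ʳ : ∀ j → πH (m ↑ʳ j) ≡ just (punchIn w j)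
  πH-↑ʳ j rewrite splitAt-↑ʳ m n j = refl

  πH-cut : πH (u ↑ˡ n) ≡ just w
  πH-cut rewrite splitAt-↑ˡ m u n with u ≟ u
  ... | yes _   = refl
  ... | no  u≢u = contradiction refl u≢u

  πH-↑ˡ-≢ : ∀ i → ¬ i ≡ u → πH (i ↑ˡ n) ≡ nothing
  πH-↑ˡ-≢ i i≢u rewrite splitAt-↑ˡ m i n with i ≟ u
  ... | yes i≡u = contradiction i≡u i≢u
  ... | no  _   = refl

  πH-≢cut⇒πG-nothing : ∀ x h → πH x ≡ just h → ¬ h ≡ w → πG x ≡ nothing
  πH-≢cut⇒πG-nothing x h πx h≢w with sumVertex m n x
  ... | fromH j = πG-↑ʳ j
  ... | fromG i with i ≟ u
  ...   | yes refl = contradiction (just-injective (trans (sym πx) πH-cut)) h≢w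
  ...   | no i≢u with trans (sym πx) (πH-↑ˡ-≢ i i≢u)
  ...     | ()

  K-↑ʳ : ∀ x j → K x (m ↑ʳ j) ≡ adjVia (adj H) (πH x) (just (punchIn w j))
  K-↑ʳ x j rewrite πG-↑ʳ j | adjVia-nothingʳ (adj G) (πG x) | πH-↑ʳ j = refl

  K-πG-nothing : ∀ x y → πG x ≡ nothing → K x y ≡ adjVia (adj H) (πH x) (πH y)
  K-πG-nothing x y πx rewrite πx = refl

  module Labelling (lab : Fin (suc n) → Block) where

    label : Fin (m + n) → Block
    label x = maybe′ lab (lab w) (πH x)

    label-↑ˡ : ∀ i → label (i ↑ˡ n) ≡ lab w
    label-↑ˡ i rewrite splitAt-↑ˡ m i n with i ≟ u
    ... | yes _ = refl
    ... | no  _ = refl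

    label-↑ʳ : ∀ j → label (m ↑ʳ j) ≡ lab (punchIn w j)
    label-↑ʳ j rewrite πH-↑ʳ j = refl

    label-surjective : ∀ b → (∃ λ z → lab z ≡ b) → ∃ λ x → label x ≡ b
    label-surjective b (z , lz) with w ≟ z
    ... | yes refl = u ↑ˡ n , trans (label-↑ˡ u) lz
    ... | no  w≢z  = m ↑ʳ punchOut w≢z ,
                     trans (label-↑ʳ (punchOut w≢z)) (trans (cong lab (punchIn-punchOut w≢z)) lz)

    label-edge-H : ∀ {b c} → (∀ h h′ → lab h ≡ b → lab h′ ≡ c → adj H h h′ ≡ false) →
                   ∀ x y → label x ≡ b → label y ≡ c → adjVia (adj H) (πH x) (πH y) ≡ false
    label-edge-H sep x y lx ly with πH x | πH y
    ... | just h  | just h′ = sep h h′ lx ly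
    ... | just _  | nothing = refl
    ... | nothing | _       = refl

    label-edge-G : ∀ x y → label x ≡ W₁ → label y ≡ W₂ → adjVia (adj G) (πG x) (πG y) ≡ false
    label-edge-G x y lx ly with sumVertex m n x | sumVertex m n y
    ... | fromH j | _       rewrite πG-↑ʳ j = refl
    ... | fromG i | fromH j rewrite πG-↑ʳ j = adjVia-nothingʳ (adj G) (πG (i ↑ˡ n))
    ... | fromG i | fromG i′ with trans (sym lx) (trans (label-↑ˡ i) (trans (sym (label-↑ˡ i′)) ly))
    ...   | ()

    module _ {b} (b≢R : isBlock R b ≡ false) where

      degH : Fin (suc n) → ℕ
      degH h = nbrsIn (adj H) lab h b

      degK : Fin (m + n) → ℕ
      degK x = nbrsIn K label x b

      degK-H-part : ∀ x h → πH x ≡ just h →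
                    count (λ j → K x (m ↑ʳ j) ∧ isBlock (label (m ↑ʳ j)) b)
                      ≡ count (λ j → adj H h (punchIn w j) ∧ isBlock (lab (punchIn w j)) b)
      degK-H-part x h πx = count-cong λ j →
        cong₂ (λ a c → a ∧ isBlock c b) (trans (K-↑ʳ x j) (cong (λ t → adjVia (adj H) t _) πx))
                                        (label-↑ʳ j)

      G-part-silent : lab w ≡ R → ∀ x i → K x (i ↑ˡ n) ∧ isBlock (label (i ↑ˡ n)) b ≡ false
      G-part-silent lw x i rewrite label-↑ˡ i | lw = ∧-isBlock-R b≢R _

      -- When the cut vertex is in R all of G is, and contributes nothing;
      -- otherwise x comes from H and can only reach G through the cut vertex.
      degK-G-part : ∀ x h → πH x ≡ just h → lab h ≡ R →
                    count (λ i → K x (i ↑ˡ n) ∧ isBlock (label (i ↑ˡ n)) b)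
                      ≡ ⟦ adj H h w ∧ isBlock (lab w) b ⟧
      degK-G-part x h πx lh with lab w ≟R
      ... | yes lw = begin
        count (λ i → K x (i ↑ˡ n) ∧ isBlock (label (i ↑ˡ n)) b) ≡⟨ count-false (G-part-silent lw x) ⟩
        0                                                       ≡⟨ cong ⟦_⟧ (sym (∧-isBlock-R b≢R _)) ⟩
        ⟦ adj H h w ∧ isBlock R b ⟧                             ≡⟨ cong (λ c → ⟦ adj H h w ∧ isBlock c b ⟧) (sym lw) ⟩
        ⟦ adj H h w ∧ isBlock (lab w) b ⟧                       ∎
        where open ≡-Reasoning
      ... | no lw≢R =
        trans (count-only u _ off) (cong₂ (λ a c → ⟦ a ∧ isBlock c b ⟧) at-cut (label-↑ˡ u))
        where
        πGx : πG x ≡ nothing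
        πGx = πH-≢cut⇒πG-nothing x h πx λ { refl → lw≢R lh }
        off : ∀ i → ¬ i ≡ u → K x (i ↑ˡ n) ∧ isBlock (label (i ↑ˡ n)) b ≡ false
        off i i≢u rewrite K-πG-nothing x (i ↑ˡ n) πGx | πH-↑ˡ-≢ i i≢u
                        | adjVia-nothingʳ (adj H) (πH x) = refl
        at-cut : K x (u ↑ˡ n) ≡ adj H h w
        at-cut rewrite K-πG-nothing x (u ↑ˡ n) πGx | πx | πH-cut = refl

      degK-from-H : ∀ x h → πH x ≡ just h → lab h ≡ R → degK x ≡ degH h
      degK-from-H x h πx lh =
        trans (count-+ m _) (trans (cong₂ _+_ (degK-G-part x h πx lh) (degK-H-part x h πx))
                                   (sym (count-punchIn w (λ z → adj H h z ∧ isBlock (lab z) b))))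

      degK-from-G : ∀ x → πH x ≡ nothing → lab w ≡ R → degK x ≡ 0
      degK-from-G x πx lw = count-false λ y → silent (sumVertex m n y)
        where
        silent : ∀ {y} → SumVertex m n y → K x y ∧ isBlock (label y) b ≡ false
        silent (fromG i) = G-part-silent lw x i
        silent (fromH j) rewrite K-↑ʳ x j | πx = refl

      label-R-cond : (∀ r → lab r ≡ R → ¬ degH r ≡ 1) → ∀ x → label x ≡ R → ¬ degK x ≡ 1
      label-R-cond cond x lx = excluded (πH x) refl
        where
        excluded : ∀ mx → πH x ≡ mx → ¬ degK x ≡ 1
        excluded nothing  πx = 0≢1+n ∘ trans (sym (degK-from-G x πx lw))
          where lw = trans (cong (maybe′ lab (lab w)) (sym πx)) lx
        excluded (just h) πx = cond h lh ∘ trans (sym (degK-from-H x h πx lh))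
          where lh = trans (cong (maybe′ lab (lab w)) (sym πx)) lx

mainTheorem12 : ∀ {m n} (G : SimpleGraph m) (H : SimpleGraph (suc n)) →
                  BarbellPartition (adj H) →
                  (u : Fin m) (w : Fin (suc n)) →
                  BarbellPartition (vertexSumAdj G H u w)
mainTheorem12 G H B u w = record
  { label       = label
  ; W₁-nonempty = label-surjective W₁ W₁-nonempty
  ; W₂-nonempty = label-surjective W₂ W₂-nonempty
  ; no-edges    = λ x y lx ly →
      cong₂ _∨_ (label-edge-G x y lx ly) (label-edge-H no-edges x y lx ly)
  ; R-cond₁     = label-R-cond refl R-cond₁
  ; R-cond₂     = label-R-cond refl R-cond₂
  }
  where
  open BarbellPartition B renaming (label to lab)
  open VertexSum G H u w
  open Labelling lab
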